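{- For a positive root $\alpha$ let $V_\alpha$ be the subspace of $(\mathfrak a_0^G)^*$ spanned by $\alpha$ and by the summands $\beta$ and $\gamma$ of all possible decompositions $\alpha=\beta+\gamma$ of $\alpha$ as a sum of two positive roots. Then $V_\alpha$ has as a basis the simple roots $\delta\in\Delta$ with $\delta\prec\alpha$.
   Context: $G$ is a split connected reductive group over $\mathbb Q$ with maximal split torus $T_0$ and Borel subgroup $P_0\supset T_0$; $\Phi\supset\Phi^+\supset\Delta$ are the (reduced) roots, positive roots and simple roots of $T_0$, viewed in $(\mathfrak a_0^G)^*$, where $\mathfrak a_0^G$ is the Lie algebra of $T_0(\mathbb R)\cap G(\mathbb R)^1$. For $\alpha\in\Phi^+$ and $\delta\in\Delta$, $\delta\prec\alpha$ means that the coefficient of $\delta$ in the expansion of $\alpha$ in simple roots is positive.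
   Formalization: The subspace $V_\alpha$, its spanning and the linear independence of the basis are taken over ℚ, in rational coordinates with respect to Δ, rather than over the reals in $(\mathfrak a_0^G)^*$. -}

module Defs where

open import Data.Nat using (ℕ; zero; suc)
open import Data.Fin using (Fin; zero; suc; _≟_)
open import Data.Integer as ℤ using (ℤ; +_)
open import Data.Rational as ℚ using (ℚ; 0ℚ; 1ℚ; _+_; _*_; -_; _/_)
open import Data.List using (List; []; _∷_; map; filter; length; lookup; foldr)
open import Data.List.Relation.Unary.Any using (Any)
open import Data.List.Relation.Unary.All using (All)
open import Data.Product using (Σ; ∃; _×_; _,_; proj₂)
open import Data.Sum using (_⊎_)
open import Relation.Nullary using (¬_; yes; no)
open import Relation.Binary.PropositionalEquality using (_≡_; _≗_)

-- Vectors of ℚ^n, identified with coordinates with respect to the simple roots Δ.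
QVec : ℕ → Set
QVec n = Fin n → ℚ

-- Integer coefficient vectors (roots written in the basis Δ).
ZVec : ℕ → Set
ZVec n = Fin n → ℤ

∑ : ∀ {n} → (Fin n → ℚ) → ℚ
∑ {zero} f = 0ℚ
∑ {suc n} f = f zero + ∑ (λ i → f (suc i))

toℚ : ℤ → ℚ
toℚ z = z / 1

toQ : ∀ {n} → ZVec n → QVec n
toQ v i = toℚ (v i)

zeroQ : ∀ {n} → QVec n
zeroQ _ = 0ℚ

-- i-th standard basis vector (the simple root δ_i).
eZ : ∀ {n} → Fin n → ZVec n
eZ i j with i ≟ j
... | yes _ = + 1
... | no _ = + 0

bil : ∀ {n} → (Fin n → Fin n → ℚ) → QVec n → QVec n → ℚ
bil B x y = ∑ (λ i → ∑ (λ j → x i * (B i j * y j)))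

_∈Z_ : ∀ {n} → ZVec n → List (ZVec n) → Set
v ∈Z L = Any (λ w → w ≗ v) L

-- A reduced (crystallographic) root system in ℚ^n, with base Δ = the
-- standard basis vectors, equipped with a rational positive-definite
-- symmetric form governing the reflections.
record RootSystemWithBase (n : ℕ) : Set where
  field
    roots   : List (ZVec n)
    form    : Fin n → Fin n → ℚ
    form-sym     : ∀ i j → form i j ≡ form j i
    form-posdef  : ∀ (x : QVec n) → ¬ (x ≗ zeroQ) → 0ℚ ℚ.< bil form x x
    root-nonzero : ∀ α → α ∈Z roots → ¬ (toQ α ≗ zeroQ)
    reduced : ∀ α β → α ∈Z roots → β ∈Z roots → (c : ℚ) →
              (toQ β ≗ (λ i → c * toQ α i)) → c ≡ 1ℚ ⊎ c ≡ - 1ℚ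
    -- crystallographic and stable under the reflections s_α:
    -- s_α(β) = β - ⟨β,α^∨⟩ α with ⟨β,α^∨⟩ = 2(β,α)/(α,α) ∈ ℤ
    reflect : ∀ α β → α ∈Z roots → β ∈Z roots →
              Σ ℤ (λ k → ((+ 2 / 1) * bil form (toQ β) (toQ α) ≡ toℚ k * bil form (toQ α) (toQ α))
                         × ((λ i → β i ℤ.- k ℤ.* α i) ∈Z roots))
    simple-roots : ∀ i → eZ i ∈Z roots
    sign : ∀ α → α ∈Z roots → (∀ i → + 0 ℤ.≤ α i) ⊎ (∀ i → α i ℤ.≤ + 0)

open RootSystemWithBase public

_∈Φ⁺_ : ∀ {n} → ZVec n → RootSystemWithBase n → Set
α ∈Φ⁺ R = α ∈Z roots R × (∀ i → + 0 ℤ.≤ α i)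

Gen : ∀ {n} → RootSystemWithBase n → ZVec n → QVec n → Set
Gen R α v = (v ≗ toQ α) ⊎
  ∃ λ β → ∃ λ γ → β ∈Φ⁺ R × γ ∈Φ⁺ R × (α ≗ (λ i → β i ℤ.+ γ i)) × ((v ≗ toQ β) ⊎ (v ≗ toQ γ))

lincomb : ∀ {n} → List (ℚ × QVec n) → QVec n
lincomb [] = zeroQ
lincomb ((q , v) ∷ cs) i = q * v i + lincomb cs i

Span : ∀ {n} → (QVec n → Set) → QVec n → Set
Span P x = ∃ λ (cs : List (ℚ × _)) → All (λ c → P (proj₂ c)) cs × (x ≗ lincomb cs)

V : ∀ {n} → RootSystemWithBase n → ZVec n → QVec n → Set
V R α = Span (Gen R α)

LinIndep : ∀ {n} → List (QVec n) → Set
LinIndep L = ∀ (c : Fin (length L) → ℚ) →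
  (λ i → ∑ (λ j → c j * lookup L j i)) ≗ zeroQ → ∀ j → c j ≡ 0ℚ

IsBasisOf : ∀ {n} → (QVec n → Set) → List (QVec n) → Set
IsBasisOf W L = All W L × (∀ x → W x → Span (λ v → Any (λ w → w ≗ v) L) x) × LinIndep L

-- The simple roots δ with δ ≺ α, i.e. positive coefficient of δ in α.
simpleBelow : ∀ {n} → ZVec n → List (QVec n)
simpleBelow {n} α = map (λ i → toQ (eZ i)) (filter (λ i → + 0 ℤ.<? α i) (Data.List.allFin n))
  where import Data.List

-- Every generator of V_α (α itself and the summands of decompositions α = β + γ into positive
-- roots) is a nonnegative vector supported where α is, so V_α lies in the span of the simple
-- roots δ ≺ α, and these are distinct coordinate vectors, hence independent.  Conversely, induct
-- on the height of α.  Since (α, α) = Σᵢ αᵢ (α, δᵢ) > 0, some simple δ ≺ α has (α, δ) > 0; if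
-- α ≠ δ then α′ = α − δ is a positive root, so α′ and δ lie in V_α, and it remains to show
-- V_α′ ⊆ V_α.  For a decomposition α′ = β + γ, one of (β, δ) < 0, (γ, δ) < 0, (α, β) > 0,
-- (α, γ) > 0 holds, and then β + δ, γ + δ, α − β or α − γ is a positive root; this exhibits β or
-- γ as a summand of α, and the other one is α′ minus it.

module Submission where

open import Algebra.Bundles using (Monoid; CommutativeRing)
import Algebra.Properties.CommutativeMonoid.Sum
import Algebra.Properties.Monoid.Sum as MonoidSum
import Algebra.Properties.Semiring.Sum
open import Data.Empty using (⊥; ⊥-elim)
open import Data.Fin using (Fin; zero; suc)
import Data.Fin.Properties as FinP
open import Data.Integer as ℤ using (ℤ; +_)
import Data.Integer.Properties as ℤP
import Data.Integer.Solver as ℤSolver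
open import Data.List using (List; []; _∷_; _++_; map; filter; tabulate; allFin; lookup)
open import Data.List.Relation.Unary.All as All using (All; []; _∷_)
import Data.List.Relation.Unary.All.Properties as AllP
import Data.List.Relation.Unary.AllPairs as AllPairs
open import Data.List.Relation.Unary.Any as Any using (Any; here; there)
open import Data.List.Relation.Unary.Unique.Propositional using (Unique)
import Data.List.Relation.Unary.Unique.Propositional.Properties as Unique
open import Data.Nat as ℕ using (ℕ; zero; suc)
import Data.Nat.Coprimality as Coprimality
import Data.Nat.Properties as ℕP
open import Data.Product using (∃; _×_; _,_; proj₁; proj₂)
open import Data.Rational as ℚ using (ℚ; mkℚ; 0ℚ; 1ℚ; _+_; _*_; -_; _/_; ↥_)
import Data.Rational.Properties as ℚP
open import Data.Rational.Solver using (module +-*-Solver)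
import Data.Rational.Unnormalised as ℚᵘ
import Data.Rational.Unnormalised.Properties as ℚᵘP
open import Data.Sum using (_⊎_; inj₁; inj₂; [_,_]′)
open import Function using (_∘_)
open import Relation.Binary.PropositionalEquality
  using (_≡_; _≢_; _≗_; refl; sym; trans; cong; cong₂; subst; subst₂; module ≡-Reasoning)
import Relation.Binary.Reasoning.Setoid as SetoidReasoning
open import Relation.Nullary using (¬_; Dec; yes; no)
open import Relation.Nullary.Decidable using (_×-dec_)
open import Relation.Unary using (Decidable)

open import Defs

fromℤ : ℤ → ℚ
fromℤ z = mkℚ z 0 (Coprimality.sym (Coprimality.1-coprimeTo _))

toℚ≡fromℤ : ∀ z → toℚ z ≡ fromℤ z
toℚ≡fromℤ z = ℚP.↥p/↧p≡p (fromℤ z)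

toℚ-injective : ∀ {a b} → toℚ a ≡ toℚ b → a ≡ b
toℚ-injective {a} {b} eq = cong ↥_ (trans (sym (toℚ≡fromℤ a)) (trans eq (toℚ≡fromℤ b)))

toℚ-homo-+ : ∀ a b → toℚ (a ℤ.+ b) ≡ toℚ a + toℚ b
toℚ-homo-+ a b rewrite toℚ≡fromℤ (a ℤ.+ b) | toℚ≡fromℤ a | toℚ≡fromℤ b = ℚP.toℚᵘ-injective
  (ℚᵘP.≃-trans (ℚᵘ.*≡* (cong₂ ℤ._*_ (sym (cong₂ ℤ._+_ (ℤP.*-identityʳ a) (ℤP.*-identityʳ b))) refl))
     (ℚᵘP.≃-sym (ℚP.toℚᵘ-homo-+ (fromℤ a) (fromℤ b))))

toℚ-homo-* : ∀ a b → toℚ (a ℤ.* b) ≡ toℚ a * toℚ b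
toℚ-homo-* a b rewrite toℚ≡fromℤ (a ℤ.* b) | toℚ≡fromℤ a | toℚ≡fromℤ b =
  ℚP.toℚᵘ-injective (ℚᵘP.≃-sym (ℚP.toℚᵘ-homo-* (fromℤ a) (fromℤ b)))

toℚ-homo‿- : ∀ a → toℚ (ℤ.- a) ≡ - toℚ a
toℚ-homo‿- a rewrite toℚ≡fromℤ (ℤ.- a) | toℚ≡fromℤ a =
  ℚP.toℚᵘ-injective (ℚᵘP.≃-sym (ℚP.toℚᵘ-homo‿- (fromℤ a)))

toℚ-mono-< : ∀ {a b} → a ℤ.< b → toℚ a ℚ.< toℚ b
toℚ-mono-< {a} {b} a<b rewrite toℚ≡fromℤ a | toℚ≡fromℤ b =
  ℚ.*<* (subst₂ ℤ._<_ (sym (ℤP.*-identityʳ a)) (sym (ℤP.*-identityʳ b)) a<b)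

toℚ-cancel-< : ∀ {a b} → toℚ a ℚ.< toℚ b → a ℤ.< b
toℚ-cancel-< {a} {b} lt rewrite toℚ≡fromℤ a | toℚ≡fromℤ b with lt
... | ℚ.*<* a<b = subst₂ ℤ._<_ (ℤP.*-identityʳ a) (ℤP.*-identityʳ b) a<b

toℚ-mono-≤ : ∀ {a b} → a ℤ.≤ b → toℚ a ℚ.≤ toℚ b
toℚ-mono-≤ {a} {b} a≤b rewrite toℚ≡fromℤ a | toℚ≡fromℤ b =
  ℚ.*≤* (subst₂ ℤ._≤_ (sym (ℤP.*-identityʳ a)) (sym (ℤP.*-identityʳ b)) a≤b)

*-pos : ∀ {p q} → 0ℚ ℚ.< p → 0ℚ ℚ.< q → 0ℚ ℚ.< p * q
*-pos {p} {q} p>0 q>0 = ℚP.positive⁻¹ (p * q) {{ℚP.pos*pos⇒pos p {{ℚ.positive p>0}} q {{ℚ.positive q>0}}}}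

*-cancelʳ-≡-pos : ∀ {p q r} → 0ℚ ℚ.< r → p * r ≡ q * r → p ≡ q
*-cancelʳ-≡-pos {r = r} r>0 pr≡qr = ℚP.≤-antisym (cancel pr≡qr) (cancel (sym pr≡qr))
  where
  cancel : ∀ {p q} → p * r ≡ q * r → p ℚ.≤ q
  cancel e = ℚP.*-cancelʳ-≤-pos r {{ℚ.positive r>0}} (ℚP.≤-reflexive e)

module _ {c ℓ} (M : Monoid c ℓ) where
  open Monoid M using (Carrier; _≈_; _∙_; ε; setoid; ∙-congˡ; ∙-congʳ; identityˡ; identityʳ)
  open MonoidSum M using (sum; sum-cong-≋; sum-replicate-zero)
  open SetoidReasoning setoid

  sum-δ : ∀ {n} (f : Fin n → Carrier) k → (∀ i → i ≢ k → f i ≈ ε) → sum f ≈ f k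
  sum-δ {suc n} f zero f≈ε = begin
    f zero ∙ sum (f ∘ suc)      ≈⟨ ∙-congˡ (sum-cong-≋ (λ i → f≈ε (suc i) λ ())) ⟩
    f zero ∙ sum {n} (λ _ → ε)  ≈⟨ ∙-congˡ (sum-replicate-zero n) ⟩
    f zero ∙ ε                  ≈⟨ identityʳ _ ⟩
    f zero                      ∎
  sum-δ f (suc k) f≈ε = begin
    f zero ∙ sum (f ∘ suc)  ≈⟨ ∙-congʳ (f≈ε zero λ ()) ⟩
    ε ∙ sum (f ∘ suc)       ≈⟨ identityˡ _ ⟩
    sum (f ∘ suc)           ≈⟨ sum-δ (f ∘ suc) k (λ i i≢k → f≈ε (suc i) (i≢k ∘ FinP.suc-injective)) ⟩
    f (suc k)               ∎

module ℚΣ = Algebra.Properties.Semiring.Sum (CommutativeRing.semiring ℚP.+-*-commutativeRing)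

∑≡sum : ∀ {n} (f : Fin n → ℚ) → ∑ f ≡ ℚΣ.sum f
∑≡sum {zero} f = refl
∑≡sum {suc n} f = cong (_+_ (f zero)) (∑≡sum (f ∘ suc))

sum-nonpos : ∀ {n} (f : Fin n → ℚ) → (∀ i → f i ℚ.≤ 0ℚ) → ℚΣ.sum f ℚ.≤ 0ℚ
sum-nonpos {zero} f _ = ℚP.≤-refl
sum-nonpos {suc n} f f≤0 = ℚP.+-mono-≤ (f≤0 zero) (sum-nonpos (f ∘ suc) (f≤0 ∘ suc))

∑-zero : ∀ {n} (f : Fin n → ℚ) → (∀ i → f i ≡ 0ℚ) → ∑ f ≡ 0ℚ
∑-zero {n} f f≡0 = trans (∑≡sum f) (trans (ℚΣ.sum-cong-≗ f≡0) (ℚΣ.sum-replicate-zero n))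

eZ-diag : ∀ {n} (j : Fin n) → eZ j j ≡ + 1
eZ-diag j with j FinP.≟ j
... | yes _ = refl
... | no j≢j = ⊥-elim (j≢j refl)

eZ-off : ∀ {n} {i j : Fin n} → i ≢ j → eZ j i ≡ + 0
eZ-off {i = i} {j} i≢j with j FinP.≟ i
... | yes j≡i = ⊥-elim (i≢j (sym j≡i))
... | no _ = refl

eZ-nonneg : ∀ {n} (j i : Fin n) → + 0 ℤ.≤ eZ j i
eZ-nonneg j i with j FinP.≟ i
... | yes _ = ℤ.+≤+ ℕ.z≤n
... | no _ = ℤ.+≤+ ℕ.z≤n

≤eZ⇒≗eZ : ∀ {n} {x : ZVec n} j → (∀ i → + 0 ℤ.≤ x i) → (∀ i → x i ℤ.≤ eZ j i) → + 0 ℤ.< x j → x ≗ eZ j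
≤eZ⇒≗eZ {x = x} j x≥0 x≤eZ x>0 i with i FinP.≟ j
... | yes refl = trans (x≡1 (x j) x>0 (subst (x j ℤ.≤_) (eZ-diag j) (x≤eZ j))) (sym (eZ-diag j))
  where
  x≡1 : ∀ a → + 0 ℤ.< a → a ℤ.≤ + 1 → a ≡ + 1
  x≡1 (+ 1) _ _ = refl
  x≡1 (+ suc (suc _)) _ (ℤ.+≤+ (ℕ.s≤s ()))
  x≡1 (+ 0) (ℤ.+<+ ()) _
... | no i≢j = trans (ℤP.≤-antisym (subst (x i ℤ.≤_) (eZ-off i≢j) (x≤eZ i)) (x≥0 i)) (sym (eZ-off i≢j))

-- Symmetric bilinear forms

module _ {n : ℕ} (B : Fin n → Fin n → ℚ) where
  open ℚΣ using (sum; sum-cong-≗; ∑-comm; ∑-distrib-+; *-distribˡ-sum)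
  open +-*-Solver
  open ≡-Reasoning

  private
    row : QVec n → Fin n → ℚ
    row y i = sum λ j → B i j * y j

  bil≡sum : ∀ x y → bil B x y ≡ sum (λ i → sum λ j → x i * (B i j * y j))
  bil≡sum x y = trans (∑≡sum (λ i → ∑ λ j → x i * (B i j * y j)))
                      (sum-cong-≗ λ i → ∑≡sum (λ j → x i * (B i j * y j)))

  private
    bil-row : ∀ x y → bil B x y ≡ sum (λ i → x i * row y i)
    bil-row x y = trans (bil≡sum x y) (sum-cong-≗ (λ i → sym (*-distribˡ-sum (x i) (λ j → B i j * y j))))

  bil-cong : ∀ {x x′ y y′} → x ≗ x′ → y ≗ y′ → bil B x y ≡ bil B x′ y′
  bil-cong {x} {x′} {y} {y′} x≗x′ y≗y′ =
    trans (bil≡sum x y)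
      (trans (sum-cong-≗ λ i → sum-cong-≗ λ j → cong₂ (λ a b → a * (B i j * b)) (x≗x′ i) (y≗y′ j))
             (sym (bil≡sum x′ y′)))

  bil-sym : (∀ i j → B i j ≡ B j i) → ∀ x y → bil B x y ≡ bil B y x
  bil-sym B-sym x y = begin
    bil B x y                                      ≡⟨ bil≡sum x y ⟩
    sum (λ i → sum λ j → x i * (B i j * y j))      ≡⟨ ∑-comm (λ i j → x i * (B i j * y j)) ⟩
    sum (λ j → sum λ i → x i * (B i j * y j))      ≡⟨ sum-cong-≗ (λ j → sum-cong-≗ λ i → swap i j) ⟩
    sum (λ j → sum λ i → y j * (B j i * x i))      ≡⟨ bil≡sum y x ⟨
    bil B y x                                      ∎
    where
    swap : ∀ i j → x i * (B i j * y j) ≡ y j * (B j i * x i)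
    swap i j = trans (cong (λ b → x i * (b * y j)) (B-sym i j))
                 (solve 3 (λ a b d → a :* (b :* d) := d :* (b :* a)) refl (x i) (B j i) (y j))

  bil-linearˡ : ∀ s u t w y → bil B (λ i → s * u i + t * w i) y ≡ s * bil B u y + t * bil B w y
  bil-linearˡ s u t w y = begin
    bil B (λ i → s * u i + t * w i) y
      ≡⟨ bil-row (λ i → s * u i + t * w i) y ⟩
    sum (λ i → (s * u i + t * w i) * row y i)
      ≡⟨ sum-cong-≗ (λ i → solve 5 (λ s u t w r → (s :* u :+ t :* w) :* r := s :* (u :* r) :+ t :* (w :* r))
                                   refl s (u i) t (w i) (row y i)) ⟩
    sum (λ i → s * (u i * row y i) + t * (w i * row y i))
      ≡⟨ ∑-distrib-+ (λ i → s * (u i * row y i)) (λ i → t * (w i * row y i)) ⟩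
    sum (λ i → s * (u i * row y i)) + sum (λ i → t * (w i * row y i))
      ≡⟨ cong₂ _+_ (*-distribˡ-sum s (λ i → u i * row y i)) (*-distribˡ-sum t (λ i → w i * row y i)) ⟨
    s * sum (λ i → u i * row y i) + t * sum (λ i → w i * row y i)
      ≡⟨ cong₂ (λ a b → s * a + t * b) (bil-row u y) (bil-row w y) ⟨
    s * bil B u y + t * bil B w y
      ∎

  bil-expandˡ : ∀ x y → bil B x y ≡ sum (λ i → x i * bil B (toQ (eZ i)) y)
  bil-expandˡ x y = trans (bil-row x y) (sum-cong-≗ (λ i → cong (x i *_) (sym (bil-δ i))))
    where
    bil-δ : ∀ k → bil B (toQ (eZ k)) y ≡ row y k
    bil-δ k = begin
      bil B (toQ (eZ k)) y                 ≡⟨ bil-row (toQ (eZ k)) y ⟩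
      sum (λ i → toQ (eZ k) i * row y i)   ≡⟨ sum-δ ℚP.+-0-monoid _ k (λ i i≢k →
                                                trans (cong (λ z → toℚ z * row y i) (eZ-off i≢k)) (ℚP.*-zeroˡ (row y i))) ⟩
      toQ (eZ k) k * row y k               ≡⟨ cong (λ z → toℚ z * row y k) (eZ-diag k) ⟩
      1ℚ * row y k                         ≡⟨ ℚP.*-identityˡ _ ⟩
      row y k                              ∎

module _ {n : ℕ} (B : Fin n → Fin n → ℚ) (B-sym : ∀ i j → B i j ≡ B j i)
         (B-posdef : ∀ x → ¬ x ≗ zeroQ → 0ℚ ℚ.< bil B x x) where
  open +-*-Solver

  cauchy-schwarz-strict : ∀ x y → ¬ y ≗ zeroQ → (∀ c → ¬ x ≗ (λ i → c * y i)) →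
                          bil B x y * bil B x y ℚ.< bil B x x * bil B y y
  cauchy-schwarz-strict x y y≢0 x≢cy =
    ℚP.*-cancelˡ-<-nonNeg q {{ℚ.nonNegative (ℚP.<⇒≤ q>0)}}
      (subst₂ ℚ._<_ (ℚP.+-identityˡ _) vv+qaa≡qpq (ℚP.+-monoˡ-< (q * (a * a)) (B-posdef v v≢0)))
    where
    p = bil B x x
    q = bil B y y
    a = bil B x y
    q>0 = B-posdef y y≢0
    v : QVec n
    v i = q * x i + (- a) * y i
    v≢0 : ¬ v ≗ zeroQ
    v≢0 v≗0 = x≢cy (ℚ.1/_ q {{ℚ.>-nonZero q>0}} * a) x≗cy
      where
      open ≡-Reasoning
      q⁻¹ = ℚ.1/_ q {{ℚ.>-nonZero q>0}}
      qx≡ay : ∀ i → q * x i ≡ a * y i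
      qx≡ay i = trans (solve 4 (λ q x a y → q :* x := (q :* x :+ (:- a) :* y) :+ a :* y) refl q (x i) a (y i))
                  (trans (cong (_+ a * y i) (v≗0 i)) (ℚP.+-identityˡ (a * y i)))
      x≗cy : x ≗ (λ i → q⁻¹ * a * y i)
      x≗cy i = begin
        x i               ≡⟨ ℚP.*-identityˡ (x i) ⟨
        1ℚ * x i          ≡⟨ cong (_* x i) (ℚP.*-inverseˡ q {{ℚ.>-nonZero q>0}}) ⟨
        q⁻¹ * q * x i     ≡⟨ ℚP.*-assoc q⁻¹ q (x i) ⟩
        q⁻¹ * (q * x i)   ≡⟨ cong (q⁻¹ *_) (qx≡ay i) ⟩
        q⁻¹ * (a * y i)   ≡⟨ ℚP.*-assoc q⁻¹ a (y i) ⟨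
        q⁻¹ * a * y i     ∎
    vv+qaa≡qpq : bil B v v + q * (a * a) ≡ q * (p * q)
    vv+qaa≡qpq = begin
      bil B v v + q * (a * a)
        ≡⟨ cong (_+ q * (a * a)) (bil-linearˡ B q x (- a) y v) ⟩
      q * bil B x v + (- a) * bil B y v + q * (a * a)
        ≡⟨ cong₂ (λ s t → q * s + (- a) * t + q * (a * a))
                 (trans (bil-sym B B-sym x v) (bil-linearˡ B q x (- a) y x))
                 (trans (bil-sym B B-sym y v) (bil-linearˡ B q x (- a) y y)) ⟩
      q * (q * p + (- a) * bil B y x) + (- a) * (q * a + (- a) * q) + q * (a * a)
        ≡⟨ cong (λ s → q * (q * p + (- a) * s) + (- a) * (q * a + (- a) * q) + q * (a * a))
                (bil-sym B B-sym y x) ⟩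
      q * (q * p + (- a) * a) + (- a) * (q * a + (- a) * q) + q * (a * a)
        ≡⟨ solve 3 (λ p q a → q :* (q :* p :+ (:- a) :* a) :+ (:- a) :* (q :* a :+ (:- a) :* q) :+ q :* (a :* a)
                              := q :* (p :* q)) refl p q a ⟩
      q * (p * q)
        ∎
      where open ≡-Reasoning

infixl 6 _+ᵛ_ _-ᵛ_
infix 8 -ᵛ_

_+ᵛ_ : ∀ {n} → ZVec n → ZVec n → ZVec n
(x +ᵛ y) i = x i ℤ.+ y i

_-ᵛ_ : ∀ {n} → ZVec n → ZVec n → ZVec n
(x -ᵛ y) i = x i ℤ.- y i

-ᵛ_ : ∀ {n} → ZVec n → ZVec n
(-ᵛ x) i = ℤ.- x i

nonneg-+≡0ˡ : ∀ {b c} → + 0 ℤ.≤ b → + 0 ℤ.≤ c → b ℤ.+ c ≡ + 0 → b ≡ + 0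
nonneg-+≡0ˡ (ℤ.+≤+ {n = b} _) (ℤ.+≤+ {n = c} _) b+c≡0 = cong +_ (ℕP.m+n≡0⇒m≡0 b (ℤP.+-injective b+c≡0))

∈Z-resp : ∀ {n} {x y : ZVec n} {L} → x ∈Z L → x ≗ y → y ∈Z L
∈Z-resp x∈L x≗y = Any.map (λ w≗x i → trans (w≗x i) (x≗y i)) x∈L

module ℕΣ = Algebra.Properties.CommutativeMonoid.Sum ℕP.+-0-commutativeMonoid

height : ∀ {n} → ZVec n → ℕ
height x = ℕΣ.sum λ i → ℤ.∣ x i ∣

height-cong : ∀ {n} {x y : ZVec n} → x ≗ y → height x ≡ height y
height-cong x≗y = ℕΣ.sum-cong-≗ (cong ℤ.∣_∣ ∘ x≗y)

height-+ᵛ : ∀ {n} {x y : ZVec n} → (∀ i → + 0 ℤ.≤ x i) → (∀ i → + 0 ℤ.≤ y i) →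
            height (x +ᵛ y) ≡ height x ℕ.+ height y
height-+ᵛ {x = x} {y} x≥0 y≥0 =
  trans (ℕΣ.sum-cong-≗ λ i → ∣+∣ (x≥0 i) (y≥0 i)) (ℕΣ.∑-distrib-+ (λ i → ℤ.∣ x i ∣) (λ i → ℤ.∣ y i ∣))
  where
  ∣+∣ : ∀ {a b} → + 0 ℤ.≤ a → + 0 ℤ.≤ b → ℤ.∣ a ℤ.+ b ∣ ≡ ℤ.∣ a ∣ ℕ.+ ℤ.∣ b ∣
  ∣+∣ (ℤ.+≤+ _) (ℤ.+≤+ _) = refl

height-eZ : ∀ {n} (j : Fin n) → height (eZ j) ≡ 1
height-eZ j = trans (sum-δ ℕP.+-0-monoid (λ i → ℤ.∣ eZ j i ∣) j (λ i i≢j → cong ℤ.∣_∣ (eZ-off i≢j)))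
                    (cong ℤ.∣_∣ (eZ-diag j))

height-+eZ : ∀ {n} {x : ZVec n} j → (∀ i → + 0 ℤ.≤ x i) → height (x +ᵛ eZ j) ≡ suc (height x)
height-+eZ {x = x} j x≥0 =
  trans (height-+ᵛ x≥0 (eZ-nonneg j)) (trans (cong (height x ℕ.+_) (height-eZ j)) (ℕP.+-comm (height x) 1))

-- Spans

module _ {n : ℕ} where
  open +-*-Solver

  private
    scale : ℚ → List (ℚ × QVec n) → List (ℚ × QVec n)
    scale s = map λ c → (s * proj₁ c , proj₂ c)

    lincomb-scale : ∀ s (cs : List (ℚ × QVec n)) i → lincomb (scale s cs) i ≡ s * lincomb cs i
    lincomb-scale s [] i = sym (ℚP.*-zeroʳ s)
    lincomb-scale s ((q , v) ∷ cs) i rewrite lincomb-scale s cs i =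
      solve 4 (λ s q v l → s :* q :* v :+ s :* l := s :* (q :* v :+ l)) refl s q (v i) (lincomb cs i)

    lincomb-++ : ∀ (cs ds : List (ℚ × QVec n)) i → lincomb (cs ++ ds) i ≡ lincomb cs i + lincomb ds i
    lincomb-++ [] ds i = sym (ℚP.+-identityˡ _)
    lincomb-++ ((q , v) ∷ cs) ds i rewrite lincomb-++ cs ds i = sym (ℚP.+-assoc (q * v i) _ _)

  module _ {P : QVec n → Set} where
    span-zero : Span P zeroQ
    span-zero = [] , [] , λ _ → refl

    span-gen : ∀ {v} → P v → Span P v
    span-gen {v} Pv = (1ℚ , v) ∷ [] , Pv ∷ [] , λ i → sym (trans (ℚP.+-identityʳ _) (ℚP.*-identityˡ (v i)))

    span-resp : ∀ {x y} → x ≗ y → Span P x → Span P y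
    span-resp x≗y (cs , P-cs , x≗cs) = cs , P-cs , λ i → trans (sym (x≗y i)) (x≗cs i)

    span-lin : ∀ {x y} s t → Span P x → Span P y → Span P (λ i → s * x i + t * y i)
    span-lin {x} {y} s t (cs , P-cs , x≗cs) (ds , P-ds , y≗ds) =
      scale s cs ++ scale t ds ,
      AllP.++⁺ (AllP.map⁺ P-cs) (AllP.map⁺ P-ds) ,
      λ i → begin
        s * x i + t * y i                               ≡⟨ cong₂ (λ a b → s * a + t * b) (x≗cs i) (y≗ds i) ⟩
        s * lincomb cs i + t * lincomb ds i             ≡⟨ cong₂ _+_ (lincomb-scale s cs i) (lincomb-scale t ds i) ⟨
        lincomb (scale s cs) i + lincomb (scale t ds) i ≡⟨ lincomb-++ (scale s cs) (scale t ds) i ⟨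
        lincomb (scale s cs ++ scale t ds) i            ∎
      where open ≡-Reasoning

    span-sub : ∀ {x y} → Span P x → Span P y → Span P (λ i → x i + (- y i))
    span-sub {x} {y} Px Py =
      span-resp (λ i → solve 2 (λ a b → con 1ℚ :* a :+ (:- con 1ℚ) :* b := a :+ (:- b)) refl (x i) (y i))
                (span-lin 1ℚ (- 1ℚ) Px Py)

  span-mono : ∀ {P Q : QVec n → Set} → (∀ {v} → P v → Span Q v) → ∀ {x} → Span P x → Span Q x
  span-mono {P} {Q} P⊆Q (cs , P-cs , x≗cs) = span-resp (sym ∘ x≗cs) (Q-lincomb cs P-cs)
    where
    Q-lincomb : ∀ cs → All (λ c → P (proj₂ c)) cs → Span Q (lincomb cs)
    Q-lincomb [] [] = span-zero
    Q-lincomb ((q , v) ∷ cs) (Pv ∷ P-cs) =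
      span-resp (λ i → cong (_+_ (q * v i)) (ℚP.*-identityˡ (lincomb cs i)))
                (span-lin q 1ℚ (P⊆Q Pv) (Q-lincomb cs P-cs))

module _ {n : ℕ} {P : Fin n → Set} (P? : Decidable P) where
  private
    e : Fin n → QVec n
    e i = toQ (eZ i)

    coordinates : QVec n → List (Fin n) → List (ℚ × QVec n)
    coordinates x = map λ i → (x i , e i)

    coordinates-∈ : ∀ x l → All (λ c → Any (_≗ proj₂ c) (map e l)) (coordinates x l)
    coordinates-∈ x [] = []
    coordinates-∈ x (i ∷ l) = here (λ _ → refl) ∷ All.map there (coordinates-∈ x l)

    lincomb-tabulate : ∀ x {m} (h : Fin m → Fin n) t →
                       lincomb (coordinates x (tabulate h)) t ≡ ℚΣ.sum (λ i → x (h i) * e (h i) t)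
    lincomb-tabulate x {zero} h t = refl
    lincomb-tabulate x {suc m} h t = cong (_+_ (x (h zero) * e (h zero) t)) (lincomb-tabulate x (h ∘ suc) t)

    lincomb-allFin : ∀ x t → lincomb (coordinates x (allFin n)) t ≡ x t
    lincomb-allFin x t = begin
      lincomb (coordinates x (allFin n)) t ≡⟨ lincomb-tabulate x (λ i → i) t ⟩
      ℚΣ.sum (λ i → x i * e i t)           ≡⟨ sum-δ ℚP.+-0-monoid _ t (λ i i≢t →
                                                trans (cong (λ a → x i * toℚ a) (eZ-off (i≢t ∘ sym))) (ℚP.*-zeroʳ (x i))) ⟩
      x t * e t t                          ≡⟨ cong (λ a → x t * toℚ a) (eZ-diag t) ⟩
      x t * 1ℚ                             ≡⟨ ℚP.*-identityʳ (x t) ⟩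
      x t                                  ∎
      where open ≡-Reasoning

  supported⇒span : ∀ {x} → (∀ i → ¬ P i → x i ≡ 0ℚ) →
                   Span (λ v → Any (_≗ v) (map (λ i → toQ (eZ i)) (filter P? (allFin n)))) x
  supported⇒span {x} x-supp =
    coordinates x (filter P? (allFin n)) ,
    coordinates-∈ x (filter P? (allFin n)) ,
    λ t → sym (trans (lincomb-filter (allFin n) t) (lincomb-allFin x t))
    where
    lincomb-filter : ∀ l t → lincomb (coordinates x (filter P? l)) t ≡ lincomb (coordinates x l) t
    lincomb-filter [] t = refl
    lincomb-filter (i ∷ l) t with P? i
    ... | yes _ = cong (_+_ (x i * e i t)) (lincomb-filter l t)
    ... | no ¬Pi = begin
      lincomb (coordinates x (filter P? l)) t    ≡⟨ lincomb-filter l t ⟩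
      lincomb (coordinates x l) t                ≡⟨ ℚP.+-identityˡ _ ⟨
      0ℚ + lincomb (coordinates x l) t           ≡⟨ cong (_+ lincomb (coordinates x l) t) (ℚP.*-zeroˡ (e i t)) ⟨
      0ℚ * e i t + lincomb (coordinates x l) t   ≡⟨ cong (λ a → a * e i t + lincomb (coordinates x l) t) (x-supp i ¬Pi) ⟨
      x i * e i t + lincomb (coordinates x l) t  ∎
      where open ≡-Reasoning

linIndep-eZ : ∀ {n} {F : List (Fin n)} → Unique F → LinIndep (map (λ i → toQ (eZ i)) F)
linIndep-eZ AllPairs.[] c _ ()
linIndep-eZ {n} {x ∷ F} (x∉F AllPairs.∷ F-unique) c ∑≗0 = λ
  { zero → c₀≡0
  ; (suc j) → linIndep-eZ F-unique (c ∘ suc) rest≗0 j }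
  where
  L = map (λ i → toQ (eZ i)) F
  rest : QVec n
  rest t = ∑ λ j → c (suc j) * lookup L j t

  vanish : ∀ {F} → All (x ≢_) F → ∀ j → lookup (map (λ i → toQ (eZ i)) F) j x ≡ 0ℚ
  vanish (x≢y ∷ _) zero = cong toℚ (eZ-off x≢y)
  vanish (_ ∷ x∉F) (suc j) = vanish x∉F j

  c₀≡0 : c zero ≡ 0ℚ
  c₀≡0 = begin
    c zero                              ≡⟨ ℚP.*-identityʳ (c zero) ⟨
    c zero * 1ℚ                         ≡⟨ cong (λ a → c zero * toℚ a) (eZ-diag x) ⟨
    c zero * toQ (eZ x) x               ≡⟨ ℚP.+-identityʳ _ ⟨
    c zero * toQ (eZ x) x + 0ℚ          ≡⟨ cong (_+_ (c zero * toQ (eZ x) x)) (∑-zero _ λ j →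
                                             trans (cong (c (suc j) *_) (vanish x∉F j)) (ℚP.*-zeroʳ (c (suc j)))) ⟨
    c zero * toQ (eZ x) x + rest x      ≡⟨ ∑≗0 x ⟩
    0ℚ                                  ∎
    where open ≡-Reasoning

  rest≗0 : rest ≗ zeroQ
  rest≗0 t = begin
    rest t                             ≡⟨ ℚP.+-identityˡ (rest t) ⟨
    0ℚ + rest t                        ≡⟨ cong (_+ rest t) (ℚP.*-zeroˡ (toQ (eZ x) t)) ⟨
    0ℚ * toQ (eZ x) t + rest t         ≡⟨ cong (λ a → a * toQ (eZ x) t + rest t) c₀≡0 ⟨
    c zero * toQ (eZ x) t + rest t     ≡⟨ ∑≗0 t ⟩
    0ℚ                                 ∎
    where open ≡-Reasoning

-- Roots

km<4⇒k≡1⊎m≡1 : ∀ {k m} → + 0 ℤ.< k → + 0 ℤ.< m → k ℤ.* m ℤ.< + 4 → k ≡ + 1 ⊎ m ≡ + 1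
km<4⇒k≡1⊎m≡1 {+ 1} _ _ _ = inj₁ refl
km<4⇒k≡1⊎m≡1 {+ suc (suc _)} {+ 1} _ _ _ = inj₂ refl
km<4⇒k≡1⊎m≡1 {+ suc (suc a)} {+ suc (suc b)} _ _ (ℤ.+<+ km<4) =
  ⊥-elim (ℕP.<⇒≱ km<4 (ℕP.*-mono-≤ {2} {suc (suc a)} {2} {suc (suc b)}
                                     (ℕ.s≤s (ℕ.s≤s ℕ.z≤n)) (ℕ.s≤s (ℕ.s≤s ℕ.z≤n))))
km<4⇒k≡1⊎m≡1 {+ 0} (ℤ.+<+ ())
km<4⇒k≡1⊎m≡1 {+ suc (suc _)} {+ 0} _ (ℤ.+<+ ())

module RootSystem {n : ℕ} (R : RootSystemWithBase n) where
  open +-*-Solver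
  private module ℤS = ℤSolver.+-*-Solver

  ⟪_,_⟫ : ZVec n → ZVec n → ℚ
  ⟪ x , y ⟫ = bil (form R) (toQ x) (toQ y)

  ⟪⟫-sym : ∀ x y → ⟪ x , y ⟫ ≡ ⟪ y , x ⟫
  ⟪⟫-sym x y = bil-sym (form R) (form-sym R) (toQ x) (toQ y)

  ⟪⟫-cong : ∀ {x x′ y y′} → x ≗ x′ → y ≗ y′ → ⟪ x , y ⟫ ≡ ⟪ x′ , y′ ⟫
  ⟪⟫-cong x≗x′ y≗y′ = bil-cong (form R) (cong toℚ ∘ x≗x′) (cong toℚ ∘ y≗y′)

  ⟪⟫-linearˡ : ∀ x s u t w z → toQ x ≗ (λ i → s * toQ u i + t * toQ w i) →
               ⟪ x , z ⟫ ≡ s * ⟪ u , z ⟫ + t * ⟪ w , z ⟫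
  ⟪⟫-linearˡ x s u t w z x≗ =
    trans (bil-cong (form R) x≗ (λ _ → refl)) (bil-linearˡ (form R) s (toQ u) t (toQ w) (toQ z))

  ⟪+⟫ˡ : ∀ x y z → ⟪ x +ᵛ y , z ⟫ ≡ ⟪ x , z ⟫ + ⟪ y , z ⟫
  ⟪+⟫ˡ x y z = trans (⟪⟫-linearˡ (x +ᵛ y) 1ℚ x 1ℚ y z (λ i → trans (toℚ-homo-+ (x i) (y i))
                       (solve 2 (λ a b → a :+ b := con 1ℚ :* a :+ con 1ℚ :* b) refl (toQ x i) (toQ y i))))
                 (solve 2 (λ a b → con 1ℚ :* a :+ con 1ℚ :* b := a :+ b) refl ⟪ x , z ⟫ ⟪ y , z ⟫)

  ⟪-⟫ˡ : ∀ x z → ⟪ -ᵛ x , z ⟫ ≡ - ⟪ x , z ⟫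
  ⟪-⟫ˡ x z = trans (⟪⟫-linearˡ (-ᵛ x) (- 1ℚ) x 0ℚ x z (λ i → trans (toℚ-homo‿- (x i))
                     (solve 1 (λ a → :- a := (:- con 1ℚ) :* a :+ con 0ℚ :* a) refl (toQ x i))))
               (solve 1 (λ a → (:- con 1ℚ) :* a :+ con 0ℚ :* a := :- a) refl ⟪ x , z ⟫)

  ⟪+⟫ʳ : ∀ x y z → ⟪ z , x +ᵛ y ⟫ ≡ ⟪ z , x ⟫ + ⟪ z , y ⟫
  ⟪+⟫ʳ x y z = trans (⟪⟫-sym z (x +ᵛ y)) (trans (⟪+⟫ˡ x y z) (cong₂ _+_ (⟪⟫-sym x z) (⟪⟫-sym y z)))

  ⟪-⟫ʳ : ∀ x z → ⟪ z , -ᵛ x ⟫ ≡ - ⟪ z , x ⟫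
  ⟪-⟫ʳ x z = trans (⟪⟫-sym z (-ᵛ x)) (trans (⟪-⟫ˡ x z) (cong -_ (⟪⟫-sym x z)))

  ⟪⟫-pos : ∀ {x} → x ∈Z roots R → 0ℚ ℚ.< ⟪ x , x ⟫
  ⟪⟫-pos {x} x∈Φ = form-posdef R (toQ x) (root-nonzero R x x∈Φ)

  -root : ∀ {x} → x ∈Z roots R → (-ᵛ x) ∈Z roots R
  -root {x} x∈Φ with reflect R x x x∈Φ x∈Φ
  ... | k , 2⟪x,x⟫≡k⟪x,x⟫ , sₓx∈Φ = ∈Z-resp sₓx∈Φ λ i →
    trans (cong (λ k → x i ℤ.- k ℤ.* x i) k≡2)
          (ℤS.solve 1 (λ a → a ℤS.:- ℤS.con (+ 2) ℤS.:* a ℤS.:= ℤS.:- a) refl (x i))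
    where
    k≡2 : k ≡ + 2
    k≡2 = toℚ-injective (sym (*-cancelʳ-≡-pos (⟪⟫-pos x∈Φ) 2⟪x,x⟫≡k⟪x,x⟫))

  roots-not-proportional : ∀ {x y} → x ∈Z roots R → y ∈Z roots R → ¬ x ≗ y → ¬ x ≗ -ᵛ y →
                           ∀ c → ¬ toQ x ≗ (λ i → c * toQ y i)
  roots-not-proportional {x} {y} x∈Φ y∈Φ x≢y x≢-y c x≗cy with reduced R y x y∈Φ x∈Φ c x≗cy
  ... | inj₁ refl = x≢y λ i → toℚ-injective (trans (x≗cy i) (ℚP.*-identityˡ (toQ y i)))
  ... | inj₂ refl = x≢-y λ i → toℚ-injective (trans (x≗cy i)
                      (trans (solve 1 (λ a → (:- con 1ℚ) :* a := :- a) refl (toQ y i)) (sym (toℚ-homo‿- (y i)))))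

  ⟪⟫²<⟪⟫⟪⟫ : ∀ {x y} → x ∈Z roots R → y ∈Z roots R → ¬ x ≗ y → ¬ x ≗ -ᵛ y →
             ⟪ x , y ⟫ * ⟪ x , y ⟫ ℚ.< ⟪ x , x ⟫ * ⟪ y , y ⟫
  ⟪⟫²<⟪⟫⟪⟫ {x} {y} x∈Φ y∈Φ x≢y x≢-y =
    cauchy-schwarz-strict (form R) (form-sym R) (form-posdef R) (toQ x) (toQ y)
      (root-nonzero R y y∈Φ) (roots-not-proportional x∈Φ y∈Φ x≢y x≢-y)

  private
    cartan-pos : ∀ {c q k} → 0ℚ ℚ.< c → 0ℚ ℚ.< q → (+ 2 / 1) * c ≡ toℚ k * q → + 0 ℤ.< k
    cartan-pos {c} {q} {k} c>0 q>0 2c≡kq =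
      toℚ-cancel-< (ℚP.*-cancelʳ-<-nonNeg q {{ℚ.nonNegative (ℚP.<⇒≤ q>0)}}
        (subst₂ ℚ._<_ (sym (ℚP.*-zeroˡ q)) 2c≡kq (*-pos (toℚ-mono-< {+ 0} {+ 2} (ℤ.+<+ (ℕ.s≤s ℕ.z≤n))) c>0)))

  -- The Cartan integers k = ⟨x, y^∨⟩ and m = ⟨y, x^∨⟩ are positive with k m = 4 (x, y)² / ((x, x) (y, y)) < 4,
  -- so one of them is 1, and the corresponding reflection maps x to x − y or y to y − x.
  root-sub : ∀ {x y} → x ∈Z roots R → y ∈Z roots R → ¬ x ≗ y → 0ℚ ℚ.< ⟪ x , y ⟫ → (x -ᵛ y) ∈Z roots R
  root-sub {x} {y} x∈Φ y∈Φ x≢y a>0 with reflect R y x y∈Φ x∈Φ | reflect R x y x∈Φ y∈Φ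
  ... | k , 2a≡kq , x-ky∈Φ | m , 2a′≡mp , y-mx∈Φ =
    [ (λ { refl → ∈Z-resp x-ky∈Φ λ i → cong (ℤ._-_ (x i)) (ℤP.*-identityˡ (y i)) })
    , (λ { refl → ∈Z-resp (-root y-mx∈Φ) λ i →
             ℤS.solve 2 (λ x y → ℤS.:- (y ℤS.:- ℤS.con (+ 1) ℤS.:* x) ℤS.:= x ℤS.:- y) refl (x i) (y i) })
    ]′ (km<4⇒k≡1⊎m≡1 (cartan-pos {k = k} a>0 q>0 2a≡kq) (cartan-pos {k = m} a>0 p>0 2a≡mp) km<4)
    where
    open ≡-Reasoning
    a = ⟪ x , y ⟫
    p = ⟪ x , x ⟫
    q = ⟪ y , y ⟫
    p>0 = ⟪⟫-pos x∈Φ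
    q>0 = ⟪⟫-pos y∈Φ
    2a≡mp : (+ 2 / 1) * a ≡ toℚ m * p
    2a≡mp = trans (cong ((+ 2 / 1) *_) (⟪⟫-sym x y)) 2a′≡mp
    x≢-y : ¬ x ≗ -ᵛ y
    x≢-y x≗-y = ℚP.<-asym a>0 (subst (ℚ._< 0ℚ) (sym (trans (⟪⟫-cong {y = y} x≗-y (λ _ → refl)) (⟪-⟫ˡ y y)))
                                 (ℚP.neg-antimono-< q>0))
    4aa≡km·pq : (+ 4 / 1) * (a * a) ≡ toℚ (k ℤ.* m) * (p * q)
    4aa≡km·pq = begin
      (+ 4 / 1) * (a * a)
        ≡⟨ solve 1 (λ a → con (+ 4 / 1) :* (a :* a) := (con (+ 2 / 1) :* a) :* (con (+ 2 / 1) :* a)) refl a ⟩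
      ((+ 2 / 1) * a) * ((+ 2 / 1) * a) ≡⟨ cong₂ _*_ 2a≡kq 2a≡mp ⟩
      (toℚ k * q) * (toℚ m * p)
        ≡⟨ solve 4 (λ k m p q → (k :* q) :* (m :* p) := (k :* m) :* (p :* q)) refl (toℚ k) (toℚ m) p q ⟩
      (toℚ k * toℚ m) * (p * q)         ≡⟨ cong (_* (p * q)) (toℚ-homo-* k m) ⟨
      toℚ (k ℤ.* m) * (p * q)           ∎
    km<4 : k ℤ.* m ℤ.< + 4
    km<4 = toℚ-cancel-< (ℚP.*-cancelʳ-<-nonNeg (p * q) {{ℚ.nonNegative (ℚP.<⇒≤ (*-pos p>0 q>0))}}
             (subst (ℚ._< toℚ (+ 4) * (p * q)) 4aa≡km·pq
               (ℚP.*-monoʳ-<-pos (+ 4 / 1) (⟪⟫²<⟪⟫⟪⟫ x∈Φ y∈Φ x≢y x≢-y))))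

  root-add : ∀ {x y} → x ∈Z roots R → y ∈Z roots R → ¬ x ≗ -ᵛ y → ⟪ x , y ⟫ ℚ.< 0ℚ → (x +ᵛ y) ∈Z roots R
  root-add {x} {y} x∈Φ y∈Φ x≢-y a<0 =
    ∈Z-resp (root-sub x∈Φ (-root y∈Φ) x≢-y (subst (0ℚ ℚ.<_) (sym (⟪-⟫ʳ y x)) (ℚP.neg-antimono-< a<0)))
            (λ i → cong (ℤ._+_ (x i)) (ℤP.neg-involutive (y i)))

  simple∈Φ⁺ : ∀ j → eZ j ∈Φ⁺ R
  simple∈Φ⁺ j = simple-roots R j , eZ-nonneg j

  nonneg≢-eZ : ∀ {x : ZVec n} j → (∀ i → + 0 ℤ.≤ x i) → ¬ x ≗ -ᵛ eZ j
  nonneg≢-eZ j x≥0 x≗-δ with subst (+ 0 ℤ.≤_) (trans (x≗-δ j) (cong ℤ.-_ (eZ-diag j))) (x≥0 j)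
  ... | ()

  ∃-simple-acute : ∀ {α} → α ∈Φ⁺ R → ∃ λ j → + 0 ℤ.< α j × 0ℚ ℚ.< ⟪ α , eZ j ⟫
  ∃-simple-acute {α} (α∈Φ , α≥0)
    with FinP.any? (λ j → (+ 0 ℤP.<? α j) ×-dec (0ℚ ℚP.<? ⟪ α , eZ j ⟫))
  ... | yes found = found
  ... | no none = ⊥-elim (ℚP.<-irrefl refl (ℚP.<-≤-trans (⟪⟫-pos α∈Φ) ⟪α,α⟫≤0))
    where
    term≤0 : ∀ i → toQ α i * ⟪ eZ i , α ⟫ ℚ.≤ 0ℚ
    term≤0 i with + 0 ℤP.<? α i
    ... | yes αᵢ>0 = subst (toQ α i * ⟪ eZ i , α ⟫ ℚ.≤_) (ℚP.*-zeroʳ (toQ α i))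
                     (ℚP.*-monoˡ-≤-nonNeg (toQ α i) {{ℚ.nonNegative (toℚ-mono-≤ (α≥0 i))}}
                       (subst (ℚ._≤ 0ℚ) (⟪⟫-sym α (eZ i)) (ℚP.≮⇒≥ λ ⟪α,eᵢ⟫>0 → none (i , αᵢ>0 , ⟪α,eᵢ⟫>0))))
    ... | no αᵢ≯0 =
      ℚP.≤-reflexive (trans (cong (λ a → toℚ a * ⟪ eZ i , α ⟫) (ℤP.≤-antisym (ℤP.≮⇒≥ αᵢ≯0) (α≥0 i)))
                            (ℚP.*-zeroˡ ⟪ eZ i , α ⟫))
    ⟪α,α⟫≤0 : ⟪ α , α ⟫ ℚ.≤ 0ℚ
    ⟪α,α⟫≤0 = subst (ℚ._≤ 0ℚ) (sym (bil-expandˡ (form R) (toQ α) (toQ α))) (sum-nonpos _ term≤0)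

  -simple∈Φ⁺ : ∀ {α} j → α ∈Φ⁺ R → + 0 ℤ.< α j → 0ℚ ℚ.< ⟪ α , eZ j ⟫ → ¬ α ≗ eZ j →
               (α -ᵛ eZ j) ∈Φ⁺ R
  -simple∈Φ⁺ {α} j (α∈Φ , α≥0) αⱼ>0 ⟪α,δ⟫>0 α≢δ =
    α-δ∈Φ ,
    [ (λ α-δ≥0 → α-δ≥0)
    , (λ α-δ≤0 → ⊥-elim (α≢δ (≤eZ⇒≗eZ j α≥0 (ℤP.i-j≤0⇒i≤j ∘ α-δ≤0) αⱼ>0)))
    ]′ (sign R _ α-δ∈Φ)
    where
    α-δ∈Φ = root-sub α∈Φ (simple-roots R j) α≢δ ⟪α,δ⟫>0

  module _ {α : ZVec n} where
    α∈V : V R α (toQ α)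
    α∈V = span-gen (inj₁ λ _ → refl)

    summandˡ∈V : ∀ {β γ} → β ∈Φ⁺ R → γ ∈Φ⁺ R → α ≗ β +ᵛ γ → V R α (toQ β)
    summandˡ∈V {β} {γ} β∈Φ⁺ γ∈Φ⁺ α≗β+γ =
      span-gen (inj₂ (β , γ , β∈Φ⁺ , γ∈Φ⁺ , α≗β+γ , inj₁ λ _ → refl))

    summandʳ∈V : ∀ {β γ} → β ∈Φ⁺ R → γ ∈Φ⁺ R → α ≗ β +ᵛ γ → V R α (toQ γ)
    summandʳ∈V {β} {γ} β∈Φ⁺ γ∈Φ⁺ α≗β+γ =
      span-gen (inj₂ (β , γ , β∈Φ⁺ , γ∈Φ⁺ , α≗β+γ , inj₂ λ _ → refl))

  module _ {α α′ : ZVec n} {j : Fin n}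
           (α∈Φ⁺ : α ∈Φ⁺ R) (α′∈Φ⁺ : α′ ∈Φ⁺ R) (α≗α′+δ : α ≗ α′ +ᵛ eZ j) where
    private
      δ = eZ j

      α≢δ : ¬ α ≗ δ
      α≢δ α≗δ = root-nonzero R α′ (proj₁ α′∈Φ⁺) λ i → cong toℚ (begin
        α′ i                 ≡⟨ ℤS.solve 2 (λ a d → a ℤS.:= (a ℤS.:+ d) ℤS.:- d) refl (α′ i) (δ i) ⟩
        (α′ i ℤ.+ δ i) ℤ.- δ i ≡⟨ cong (ℤ._- δ i) (trans (sym (α≗α′+δ i)) (α≗δ i)) ⟩
        δ i ℤ.- δ i            ≡⟨ ℤP.+-inverseʳ (δ i) ⟩
        + 0                    ∎)
        where open ≡-Reasoning

      α≗β+γ+δ : ∀ {β γ} → α′ ≗ β +ᵛ γ → α ≗ β +ᵛ γ +ᵛ δ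
      α≗β+γ+δ α′≗β+γ i = trans (α≗α′+δ i) (cong (ℤ._+ δ i) (α′≗β+γ i))

      +δ∈Φ⁺ : ∀ {β} → β ∈Φ⁺ R → ⟪ β , δ ⟫ ℚ.< 0ℚ → (β +ᵛ δ) ∈Φ⁺ R
      +δ∈Φ⁺ (β∈Φ , β≥0) ⟪β,δ⟫<0 =
        root-add β∈Φ (simple-roots R j) (nonneg≢-eZ j β≥0) ⟪β,δ⟫<0 , λ i → ℤP.+-mono-≤ (β≥0 i) (eZ-nonneg j i)

      α-β∈Φ⁺ : ∀ {β γ} → β ∈Φ⁺ R → γ ∈Φ⁺ R → α′ ≗ β +ᵛ γ → 0ℚ ℚ.< ⟪ α , β ⟫ → (α -ᵛ β) ∈Φ⁺ R
      α-β∈Φ⁺ {β} {γ} (β∈Φ , _) (_ , γ≥0) α′≗β+γ ⟪α,β⟫>0 =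
        root-sub (proj₁ α∈Φ⁺) β∈Φ α≢β ⟪α,β⟫>0 ,
        λ i → subst (+ 0 ℤ.≤_) (sym (α-β≗γ+δ i)) (ℤP.+-mono-≤ (γ≥0 i) (eZ-nonneg j i))
        where
        α-β≗γ+δ : α -ᵛ β ≗ γ +ᵛ δ
        α-β≗γ+δ i = trans (cong (ℤ._- β i) (α≗β+γ+δ {β} {γ} α′≗β+γ i))
                      (ℤS.solve 3 (λ b c d → (b ℤS.:+ c ℤS.:+ d) ℤS.:- b ℤS.:= c ℤS.:+ d) refl (β i) (γ i) (δ i))
        α≢β : ¬ α ≗ β
        α≢β α≗β = ℤP.<⇒≢ (subst (+ 0 ℤ.<_) (sym (α-β≗γ+δ j))
                            (ℤP.+-mono-≤-< (γ≥0 j) (subst (+ 0 ℤ.<_) (sym (eZ-diag j)) (ℤ.+<+ (ℕ.s≤s ℕ.z≤n)))))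
                         (sym (ℤP.i≡j⇒i-j≡0 (α≗β j)))

      -- Otherwise (α, α) ≤ (α, δ) and (δ, δ) ≤ (α, δ), against the strict Cauchy–Schwarz inequality for α ≠ ±δ.
      not-all-obtuse : ∀ {β γ} → α′ ≗ β +ᵛ γ → 0ℚ ℚ.≤ ⟪ β , δ ⟫ → 0ℚ ℚ.≤ ⟪ γ , δ ⟫ →
                       ⟪ α , β ⟫ ℚ.≤ 0ℚ → ⟪ α , γ ⟫ ℚ.≤ 0ℚ → ⊥
      not-all-obtuse {β} {γ} α′≗β+γ ⟪β,δ⟫≥0 ⟪γ,δ⟫≥0 ⟪α,β⟫≤0 ⟪α,γ⟫≤0 =
        ℚP.<-irrefl refl
          (ℚP.<-≤-trans (⟪⟫²<⟪⟫⟪⟫ (proj₁ α∈Φ⁺) (simple-roots R j) α≢δ (nonneg≢-eZ j (proj₂ α∈Φ⁺)))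
                        (ℚP.≤-trans AD≤cD cD≤cc))
        where
        A = ⟪ α , α ⟫
        c = ⟪ α , δ ⟫
        D = ⟪ δ , δ ⟫
        D>0 = ⟪⟫-pos (simple-roots R j)
        A≡ : A ≡ ⟪ α , β ⟫ + ⟪ α , γ ⟫ + c
        A≡ = trans (⟪⟫-cong {x = α} (λ _ → refl) (α≗β+γ+δ {β} {γ} α′≗β+γ))
               (trans (⟪+⟫ʳ (β +ᵛ γ) δ α) (cong (_+ c) (⟪+⟫ʳ β γ α)))
        c≡ : c ≡ ⟪ β , δ ⟫ + ⟪ γ , δ ⟫ + D
        c≡ = trans (⟪⟫-cong {y = δ} (α≗β+γ+δ {β} {γ} α′≗β+γ) (λ _ → refl))
               (trans (⟪+⟫ˡ (β +ᵛ γ) δ δ) (cong (_+ D) (⟪+⟫ˡ β γ δ)))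
        A≤c : A ℚ.≤ c
        A≤c = subst₂ ℚ._≤_ (sym A≡) (ℚP.+-identityˡ c)
                (ℚP.+-mono-≤ (ℚP.+-mono-≤ {y = 0ℚ} ⟪α,β⟫≤0 ⟪α,γ⟫≤0) (ℚP.≤-refl {c}))
        D≤c : D ℚ.≤ c
        D≤c = subst₂ ℚ._≤_ (ℚP.+-identityˡ D) (sym c≡)
                (ℚP.+-mono-≤ (ℚP.+-mono-≤ {x = 0ℚ} ⟪β,δ⟫≥0 ⟪γ,δ⟫≥0) (ℚP.≤-refl {D}))
        AD≤cD : A * D ℚ.≤ c * D
        AD≤cD = ℚP.*-monoʳ-≤-nonNeg D {{ℚ.nonNegative (ℚP.<⇒≤ D>0)}} A≤c
        cD≤cc : c * D ℚ.≤ c * c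
        cD≤cc = ℚP.*-monoˡ-≤-nonNeg c {{ℚ.nonNegative (ℚP.≤-trans (ℚP.<⇒≤ D>0) D≤c)}} D≤c

      summand∈V : ∀ {β γ} → β ∈Φ⁺ R → γ ∈Φ⁺ R → α′ ≗ β +ᵛ γ →
                  ⟪ γ , δ ⟫ ℚ.< 0ℚ ⊎ 0ℚ ℚ.< ⟪ α , β ⟫ → V R α (toQ β)
      summand∈V {β} {γ} β∈Φ⁺ γ∈Φ⁺ α′≗β+γ (inj₁ ⟪γ,δ⟫<0) =
        summandˡ∈V β∈Φ⁺ (+δ∈Φ⁺ γ∈Φ⁺ ⟪γ,δ⟫<0) λ i →
          trans (α≗β+γ+δ {β} {γ} α′≗β+γ i) (ℤP.+-assoc (β i) (γ i) (δ i))
      summand∈V {β} {γ} β∈Φ⁺ γ∈Φ⁺ α′≗β+γ (inj₂ ⟪α,β⟫>0) =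
        summandˡ∈V β∈Φ⁺ (α-β∈Φ⁺ β∈Φ⁺ γ∈Φ⁺ α′≗β+γ ⟪α,β⟫>0) λ i →
          ℤS.solve 2 (λ a b → a ℤS.:= b ℤS.:+ (a ℤS.:- b)) refl (α i) (β i)

      summand-criterion : ∀ {β γ} → α′ ≗ β +ᵛ γ →
                          (⟪ γ , δ ⟫ ℚ.< 0ℚ ⊎ 0ℚ ℚ.< ⟪ α , β ⟫) ⊎ (⟪ β , δ ⟫ ℚ.< 0ℚ ⊎ 0ℚ ℚ.< ⟪ α , γ ⟫)
      summand-criterion {β} {γ} α′≗β+γ
        with ⟪ γ , δ ⟫ ℚP.<? 0ℚ | 0ℚ ℚP.<? ⟪ α , β ⟫ | ⟪ β , δ ⟫ ℚP.<? 0ℚ | 0ℚ ℚP.<? ⟪ α , γ ⟫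
      ... | yes p | _     | _     | _     = inj₁ (inj₁ p)
      ... | no _  | yes p | _     | _     = inj₁ (inj₂ p)
      ... | no _  | no _  | yes p | _     = inj₂ (inj₁ p)
      ... | no _  | no _  | no _  | yes p = inj₂ (inj₂ p)
      ... | no ¬a | no ¬b | no ¬c | no ¬d =
        ⊥-elim (not-all-obtuse {β} {γ} α′≗β+γ (ℚP.≮⇒≥ ¬c) (ℚP.≮⇒≥ ¬a) (ℚP.≮⇒≥ ¬b) (ℚP.≮⇒≥ ¬d))

      α′∈V : V R α (toQ α′)
      α′∈V = summandˡ∈V α′∈Φ⁺ (simple∈Φ⁺ j) α≗α′+δ

      summand-of-α′∈V : ∀ {β γ} → β ∈Φ⁺ R → γ ∈Φ⁺ R → α′ ≗ β +ᵛ γ → V R α (toQ β)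
      summand-of-α′∈V {β} {γ} β∈Φ⁺ γ∈Φ⁺ α′≗β+γ with summand-criterion {β} {γ} α′≗β+γ
      ... | inj₁ β-criterion = summand∈V β∈Φ⁺ γ∈Φ⁺ α′≗β+γ β-criterion
      ... | inj₂ γ-criterion =
        span-resp β≗α′-γ
          (span-sub α′∈V (summand∈V γ∈Φ⁺ β∈Φ⁺ (λ i → trans (α′≗β+γ i) (ℤP.+-comm (β i) (γ i))) γ-criterion))
        where
        β≗α′-γ : (λ i → toQ α′ i + - toQ γ i) ≗ toQ β
        β≗α′-γ i = begin
          toQ α′ i + - toQ γ i          ≡⟨ cong (λ a → toℚ a + - toQ γ i) (α′≗β+γ i) ⟩
          toℚ (β i ℤ.+ γ i) + - toQ γ i ≡⟨ cong (_+ - toQ γ i) (toℚ-homo-+ (β i) (γ i)) ⟩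
          toQ β i + toQ γ i + - toQ γ i ≡⟨ solve 2 (λ b c → b :+ c :+ (:- c) := b) refl (toQ β i) (toQ γ i) ⟩
          toQ β i                       ∎
          where open ≡-Reasoning

      Gen-α′⊆V : ∀ {v} → Gen R α′ v → V R α v
      Gen-α′⊆V (inj₁ v≗α′) = span-resp (sym ∘ v≗α′) α′∈V
      Gen-α′⊆V (inj₂ (β , γ , β∈Φ⁺ , γ∈Φ⁺ , α′≗β+γ , inj₁ v≗β)) =
        span-resp (sym ∘ v≗β) (summand-of-α′∈V β∈Φ⁺ γ∈Φ⁺ α′≗β+γ)
      Gen-α′⊆V (inj₂ (β , γ , β∈Φ⁺ , γ∈Φ⁺ , α′≗β+γ , inj₂ v≗γ)) =
        span-resp (sym ∘ v≗γ) (summand-of-α′∈V γ∈Φ⁺ β∈Φ⁺ λ i → trans (α′≗β+γ i) (ℤP.+-comm (β i) (γ i)))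

    V-mono-+simple : ∀ {x} → V R α′ x → V R α x
    V-mono-+simple = span-mono Gen-α′⊆V

  simple≺α∈V : ∀ N {α} → height α ℕ.< N → α ∈Φ⁺ R → ∀ {k} → + 0 ℤ.< α k → V R α (toQ (eZ k))
  simple≺α∈V (suc N) {α} ht<N α∈Φ⁺ {k} αₖ>0 = by-cases (∃-simple-acute α∈Φ⁺)
    where
    α≗α-δ+δ : ∀ j → α ≗ (α -ᵛ eZ j) +ᵛ eZ j
    α≗α-δ+δ j i = ℤS.solve 2 (λ a d → a ℤS.:= (a ℤS.:- d) ℤS.:+ d) refl (α i) (eZ j i)

    descend : ∀ {j} → (α -ᵛ eZ j) ∈Φ⁺ R → Dec (k ≡ j) → V R α (toQ (eZ k))
    descend {j} α′∈Φ⁺ (yes refl) = summandʳ∈V α′∈Φ⁺ (simple∈Φ⁺ j) (α≗α-δ+δ j)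
    descend {j} α′∈Φ⁺ (no k≢j) =
      V-mono-+simple α∈Φ⁺ α′∈Φ⁺ (α≗α-δ+δ j) (simple≺α∈V N ht′<N α′∈Φ⁺ α′ₖ>0)
      where
      ht′<N : height (α -ᵛ eZ j) ℕ.< N
      ht′<N = ℕP.≤-pred (subst (ℕ._< suc N) (trans (height-cong (α≗α-δ+δ j)) (height-+eZ j (proj₂ α′∈Φ⁺)))
                               ht<N)
      α′ₖ>0 : + 0 ℤ.< α k ℤ.- eZ j k
      α′ₖ>0 = subst (+ 0 ℤ.<_) (sym (trans (cong (ℤ._-_ (α k)) (eZ-off k≢j)) (ℤP.+-identityʳ (α k)))) αₖ>0

    by-cases : (∃ λ j → + 0 ℤ.< α j × 0ℚ ℚ.< ⟪ α , eZ j ⟫) → V R α (toQ (eZ k))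
    by-cases (j , αⱼ>0 , ⟪α,δ⟫>0) with FinP.all? (λ i → α i ℤP.≟ eZ j i) | k FinP.≟ j
    ... | yes α≗δ | yes refl = span-resp (cong toℚ ∘ α≗δ) α∈V
    ... | yes α≗δ | no k≢j = ⊥-elim (ℤP.<⇒≢ αₖ>0 (sym (trans (α≗δ k) (eZ-off k≢j))))
    ... | no α≢δ | k≟j = descend (-simple∈Φ⁺ j α∈Φ⁺ αⱼ>0 ⟪α,δ⟫>0 α≢δ) k≟j

  simpleBelow⊆V : ∀ {α} → α ∈Φ⁺ R → All (V R α) (simpleBelow α)
  simpleBelow⊆V {α} α∈Φ⁺ =
    AllP.map⁺ (All.map (simple≺α∈V (suc (height α)) (ℕP.n<1+n (height α)) α∈Φ⁺)
                       (AllP.all-filter (λ i → + 0 ℤ.<? α i) (allFin n)))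

  V⊆span-simpleBelow : ∀ {α} → α ∈Φ⁺ R → ∀ x → V R α x → Span (λ v → Any (λ w → w ≗ v) (simpleBelow α)) x
  V⊆span-simpleBelow {α} (_ , α≥0) x = span-mono Gen⊆span
    where
    InSimpleBelow : QVec n → Set
    InSimpleBelow v = Any (λ w → w ≗ v) (simpleBelow α)

    supported : ∀ {β} → (∀ i → ¬ + 0 ℤ.< α i → β i ≡ + 0) → Span InSimpleBelow (toQ β)
    supported β-supp = supported⇒span (λ i → + 0 ℤ.<? α i) (λ i αᵢ≯0 → cong toℚ (β-supp i αᵢ≯0))

    αᵢ≡0 : ∀ i → ¬ + 0 ℤ.< α i → α i ≡ + 0
    αᵢ≡0 i αᵢ≯0 = ℤP.≤-antisym (ℤP.≮⇒≥ αᵢ≯0) (α≥0 i)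

    Gen⊆span : ∀ {v} → Gen R α v → Span InSimpleBelow v
    Gen⊆span (inj₁ v≗α) = span-resp (sym ∘ v≗α) (supported αᵢ≡0)
    Gen⊆span (inj₂ (β , γ , (_ , β≥0) , (_ , γ≥0) , α≗β+γ , inj₁ v≗β)) =
      span-resp (sym ∘ v≗β) (supported λ i αᵢ≯0 →
        nonneg-+≡0ˡ (β≥0 i) (γ≥0 i) (trans (sym (α≗β+γ i)) (αᵢ≡0 i αᵢ≯0)))
    Gen⊆span (inj₂ (β , γ , (_ , β≥0) , (_ , γ≥0) , α≗β+γ , inj₂ v≗γ)) =
      span-resp (sym ∘ v≗γ) (supported λ i αᵢ≯0 →
        nonneg-+≡0ˡ (γ≥0 i) (β≥0 i) (trans (ℤP.+-comm (γ i) (β i)) (trans (sym (α≗β+γ i)) (αᵢ≡0 i αᵢ≯0))))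

lemma4p17 : ∀ {n : ℕ} (R : RootSystemWithBase n) (α : ZVec n) →
    α ∈Φ⁺ R → IsBasisOf (V R α) (simpleBelow α)
lemma4p17 {n} R α α∈Φ⁺ =
  simpleBelow⊆V α∈Φ⁺ ,
  V⊆span-simpleBelow α∈Φ⁺ ,
  linIndep-eZ (Unique.filter⁺ (λ i → + 0 ℤ.<? α i) (Unique.allFin⁺ n))
  where open RootSystem R
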